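{- For all integers $k\geq 3$ and $n\geq 3$, the book graph $B_k^n$ is total prime.
   Context: All graphs are finite and simple. For a graph $G$ with vertex set $V$ and edge set $E$, a total prime labeling is a bijection $\ell: V\cup E\to\{1,2,\ldots,|V|+|E|\}$ such that (i) for every pair of adjacent vertices $u,v$, $\gcd(\ell(u),\ell(v))=1$, and (ii) for every vertex $v$ of degree at least 2, the greatest common divisor of the labels $\ell(uv)$ over all edges $uv$ incident to $v$ equals 1. A graph is total prime if it admits a total prime labeling. The book graph $B_k^n$ consists of $n$ cycles of length $k$ that all share exactly one common edge $uv$ (and hence its two endpoints) and are otherwise vertex-disjoint: for $i=1,\ldots,n$ the $i$th cycle is $u,x_{i,1},\ldots,x_{i,k-2},v,u$. It has $n(k-2)+2$ vertices and $n(k-1)+1$ edges. -}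

module Defs where

open import Data.Nat using (ℕ; zero; suc; _+_; _*_; _∸_; _≤_)
import Data.Nat as ℕ
open import Data.Nat.GCD using (gcd)
open import Data.Fin using (Fin; zero; suc; toℕ; inject₁; lower₁; combine; remQuot; _≟_)
open import Data.List using (List; length; map; foldr; filter; allFin)
open import Data.Product using (_×_; _,_; proj₁; proj₂; Σ; ∃)
open import Data.Sum using (_⊎_; inj₁; inj₂)
open import Function using (_⤖_; _∘_)
open import Function.Bundles using (Bijection)
open import Relation.Binary.PropositionalEquality using (_≡_; sym)
open import Relation.Nullary using (yes; no)
open import Relation.Nullary.Decidable using (_⊎-dec_)

record Graph : Set where
  field
    nV   : ℕ
    nE   : ℕ
    ends : Fin nE → Fin nV × Fin nV

module _ (G : Graph) where
  open Graph G

  Adjacent : Fin nV → Fin nV → Set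
  Adjacent a b = Σ (Fin nE) λ e → (ends e ≡ (a , b)) ⊎ (ends e ≡ (b , a))

  Incident : Fin nV → Fin nE → Set
  Incident w e = (proj₁ (ends e) ≡ w) ⊎ (proj₂ (ends e) ≡ w)

  incidentEdges : Fin nV → List (Fin nE)
  incidentEdges w = filter (λ e → (proj₁ (ends e) ≟ w) ⊎-dec (proj₂ (ends e) ≟ w)) (allFin nE)

  degree : Fin nV → ℕ
  degree w = length (incidentEdges w)

  gcdList : List ℕ → ℕ
  gcdList = foldr gcd 0

  -- A total prime labeling: a bijection from V ⊎ E onto {1, …, |V|+|E|}
  -- (represented as Fin (|V|+|E|), label = 1 + toℕ)
  record TotalPrimeLabeling : Set where
    field
      ℓ : (Fin nV ⊎ Fin nE) ⤖ Fin (nV + nE)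
    label : Fin nV ⊎ Fin nE → ℕ
    label x = suc (toℕ (Bijection.to ℓ x))
    field
      vertexCond : ∀ a b → Adjacent a b → gcd (label (inj₁ a)) (label (inj₁ b)) ≡ 1
      edgeCond   : ∀ w → 2 ≤ degree w →
                   gcdList (map (λ e → label (inj₂ e)) (incidentEdges w)) ≡ 1

  TotalPrime : Set
  TotalPrime = TotalPrimeLabeling

-- Book graph B_k^n, with m = k - 2 internal vertices per cycle.
-- Vertices: 0 = u, 1 = v, 2 + combine i j = x_{i,j+1}  (i < n, j < m).
-- Edges: 0 = uv;  1 + combine i j (i < n, j < m+1) = j-th edge of cycle i,
-- joining positions j and j+1 of the path u, x_{i,1}, …, x_{i,m}, v.
module BookDef (k n : ℕ) where
  m : ℕ
  m = k ∸ 2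

  NV : ℕ
  NV = 2 + n * m

  NE : ℕ
  NE = suc (n * suc m)

  uV : Fin NV
  uV = zero

  vV : Fin NV
  vV = suc zero

  xV : Fin n → Fin m → Fin NV
  xV i j = suc (suc (combine i j))

  -- position q+1 on cycle i (q : Fin (m+1)): x_{i,q+1} if q < m, else v
  posS : Fin n → Fin (suc m) → Fin NV
  posS i q with toℕ q ℕ.≟ m
  ... | yes _ = vV
  ... | no ne = xV i (lower₁ q (ne ∘ sym))

  pos : Fin n → Fin (suc (suc m)) → Fin NV
  pos i zero    = uV
  pos i (suc q) = posS i q

  endsB : Fin NE → Fin NV × Fin NV
  endsB zero = uV , vV
  endsB (suc e) with remQuot (suc m) e
  ... | i , j = pos i (inject₁ j) , pos i (suc j)

Book : ℕ → ℕ → Graph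
Book k n = record { nV = BookDef.NV k n ; nE = BookDef.NE k n ; ends = BookDef.endsB k n }

{-# OPTIONS --safe #-}
module Submission where

-- Write m = k - 2 for the number of internal vertices of a page. Label v, uv, u by 1, 2, 3 and
-- give page i the block of 2m + 1 consecutive labels starting at a_i = 4 + (2m + 1) i: first its
-- internal vertices in path order, then its edges in path order. Neighbouring internal vertices
-- then carry consecutive labels, as do the two edges at an internal vertex, and v carries 1.
-- The remaining adjacency, u ~ x_{i,1}, needs 3 ∤ ℓ(x_{i,1}); when 3 ∣ a_i the internal vertices
-- of page i are listed in reverse, so x_{i,1} gets a_i + m - 1, and 3 ∣ a_i + m - 1 would force
-- 3 ∣ m - 1, hence 3 ∣ 2m + 1 and 3 ∣ a_i - (2m + 1) i = 4. The edge labels at u include 2 and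
-- a_0 + m, a_1 + m, whose sum is odd; at v they include 2 and the odd a_1 + 2m. So two pages
-- suffice.

open import Data.Nat using (ℕ; suc; _≟_; _+_; _*_; _≤_; s≤s; z≤n)
open import Data.Nat.Properties using (+-comm; +-suc; +-identityʳ)
open import Data.Nat.Divisibility
  using (_∣_; _∣?_; ∣-refl; ∣-trans; ∣1⇒≡1; ∣m∣n⇒∣m+n; ∣m+n∣m⇒∣n; m∣m*n; ∣m⇒∣m*n)
open import Data.Nat.GCD using (gcd; gcd[m,n]∣m; gcd[m,n]∣n; gcd-comm; gcd-zeroʳ)
open import Data.Nat.Coprimality using (coprime⇒gcd≡1)
open import Data.Nat.Primality using (Prime; prime?; prime⇒irreducible)
open import Data.Nat.Tactic.RingSolver using (solve-∀)
open import Data.Fin.Base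
  using (Fin; zero; suc; toℕ; fromℕ; inject₁; combine; remQuot; join; splitAt; cast; opposite)
open import Data.Fin.Properties
  using ( toℕ-fromℕ; toℕ-inject₁; toℕ-inject₁-≢; lower₁-inject₁′; toℕ-cast; cast-involutive
        ; toℕ-combine; toℕ-↑ˡ; toℕ-↑ʳ; remQuot-combine; combine-remQuot; splitAt-join
        ; join-splitAt; opposite-involutive; opposite-suc)
open import Data.Fin.Relation.Unary.Top using (view; ‵fromℕ; ‵inj₁)
open import Data.List using (List; _∷_; map; foldr)
open import Data.List.Membership.Propositional using (_∈_)
open import Data.List.Membership.Propositional.Properties using (∈-map⁺; ∈-filter⁺; ∈-allFin)
open import Data.List.Relation.Unary.Any using (here; there)
open import Data.Product using (_×_; _,_; proj₁; proj₂; uncurry)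
open import Data.Sum using (_⊎_; inj₁; inj₂; [_,_])
import Data.Sum as Sum
open import Function using (_∘_; id; _↔_; _⤖_; mk↔ₛ′)
open import Function.Bundles using (Bijection)
open import Function.Properties.Inverse using (↔-trans; ↔⇒⤖)
open import Relation.Nullary using (¬_; yes; no; contradiction)
open import Relation.Nullary.Decidable using (from-yes; from-no)
open import Relation.Binary.PropositionalEquality
  using (_≡_; refl; sym; trans; cong; cong₂; subst; subst₂; module ≡-Reasoning)

open import Defs

Consecutive : ℕ → ℕ → Set
Consecutive a b = b ≡ suc a ⊎ a ≡ suc b

+-consecutive : ∀ c {a b} → Consecutive a b → Consecutive (c + a) (c + b)
+-consecutive c (inj₁ refl) = inj₁ (+-suc c _)
+-consecutive c (inj₂ refl) = inj₂ (+-suc c _)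

∣1+n∧∣n⇒∣1 : ∀ {n d} → d ∣ suc n → d ∣ n → d ∣ 1
∣1+n∧∣n⇒∣1 {n} {d} d∣1+n = ∣m+n∣m⇒∣n (subst (d ∣_) (+-comm 1 n) d∣1+n)

consecutive⇒∣1 : ∀ {a b d} → Consecutive a b → d ∣ a → d ∣ b → d ∣ 1
consecutive⇒∣1 (inj₁ refl) d∣a   d∣1+a = ∣1+n∧∣n⇒∣1 d∣1+a d∣a
consecutive⇒∣1 (inj₂ refl) d∣1+b d∣b   = ∣1+n∧∣n⇒∣1 d∣1+b d∣b

consecutive⇒gcd≡1 : ∀ {a b} → Consecutive a b → gcd a b ≡ 1
consecutive⇒gcd≡1 {a} {b} c = ∣1⇒≡1 (consecutive⇒∣1 c (gcd[m,n]∣m a b) (gcd[m,n]∣n a b))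

∣2∧∣1+2q⇒∣1 : ∀ {d} q → d ∣ 2 → d ∣ 1 + 2 * q → d ∣ 1
∣2∧∣1+2q⇒∣1 q d∣2 d∣1+2q = ∣1+n∧∣n⇒∣1 d∣1+2q (∣-trans d∣2 (m∣m*n q))

prime∤⇒gcd≡1 : ∀ {p n} → Prime p → ¬ p ∣ n → gcd p n ≡ 1
prime∤⇒gcd≡1 p-prime p∤n = coprime⇒gcd≡1 λ (d∣p , d∣n) →
  [ id , (λ { refl → contradiction d∣n p∤n }) ] (prime⇒irreducible p-prime d∣p)

prime[3] : Prime 3
prime[3] = from-yes (prime? 3)

foldr-gcd∣ : ∀ {xs : List ℕ} {x} → x ∈ xs → foldr gcd 0 xs ∣ x
foldr-gcd∣ {y ∷ ys} (here refl)  = gcd[m,n]∣m y (foldr gcd 0 ys)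
foldr-gcd∣ {y ∷ ys} (there x∈ys) = ∣-trans (gcd[m,n]∣n y (foldr gcd 0 ys)) (foldr-gcd∣ x∈ys)

foldr-gcd≡1 : ∀ {xs : List ℕ} → (∀ {d} → (∀ {x} → x ∈ xs → d ∣ x) → d ∣ 1) → foldr gcd 0 xs ≡ 1
foldr-gcd≡1 common⇒∣1 = ∣1⇒≡1 (common⇒∣1 foldr-gcd∣)

toℕ-opposite-inject₁ : ∀ {n} (i : Fin n) → toℕ (opposite (inject₁ i)) ≡ suc (toℕ (opposite i))
toℕ-opposite-inject₁ zero    = refl
toℕ-opposite-inject₁ (suc i) = begin
  toℕ (inject₁ (opposite (inject₁ i))) ≡⟨ toℕ-inject₁ (opposite (inject₁ i)) ⟩
  toℕ (opposite (inject₁ i))           ≡⟨ toℕ-opposite-inject₁ i ⟩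
  suc (toℕ (opposite i))               ≡⟨ cong suc (toℕ-inject₁ (opposite i)) ⟨
  suc (toℕ (inject₁ (opposite i)))     ∎
  where open ≡-Reasoning

data CombineView (a b : ℕ) : Fin (a * b) → Set where
  combined : (i : Fin a) (j : Fin b) → CombineView a b (combine i j)

combineView : ∀ a b (c : Fin (a * b)) → CombineView a b c
combineView a b c = subst (CombineView a b) (combine-remQuot {a} b c) (combined _ _)

cast↔ : ∀ {m n} → m ≡ n → Fin m ↔ Fin n
cast↔ eq =
  mk↔ₛ′ (cast eq) (cast (sym eq)) (cast-involutive eq (sym eq)) (cast-involutive (sym eq) eq)

incident⇒∈incidentEdges : ∀ G {w e} → Incident G w e → e ∈ incidentEdges G w
incident⇒∈incidentEdges G {e = e} = ∈-filter⁺ _ (∈-allFin e)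

-- Pages are counted as n = 2 + n′ and internal vertices per page as m = 1 + m′, so that Fin n and
-- Fin m can be matched on.
module BookLabelling (m′ n′ : ℕ) where
  open BookDef (3 + m′) (2 + n′)

  n : ℕ
  n = 2 + n′

  blockSize : ℕ
  blockSize = m + suc m

  blockStart : Fin n → ℕ
  blockStart i = 4 + blockSize * toℕ i

  3∣blockStart⇒3∤blockStart+m′ : ∀ i → 3 ∣ blockStart i → ¬ 3 ∣ blockStart i + m′
  3∣blockStart⇒3∤blockStart+m′ i 3∣a 3∣a+m′ = from-no (3 ∣? 4) 3∣4
    where
    3∣m′ : 3 ∣ m′
    3∣m′ = ∣m+n∣m⇒∣n 3∣a+m′ 3∣a
    blockSize≡3+2m′ : ∀ t → 3 + (t + t) ≡ suc t + suc (suc t)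
    blockSize≡3+2m′ = solve-∀
    3∣blockSize : 3 ∣ blockSize
    3∣blockSize = subst (3 ∣_) (blockSize≡3+2m′ m′) (∣m∣n⇒∣m+n ∣-refl (∣m∣n⇒∣m+n 3∣m′ 3∣m′))
    3∣4 : 3 ∣ 4
    3∣4 = ∣m+n∣m⇒∣n (subst (3 ∣_) (+-comm 4 _) 3∣a) (∣m⇒∣m*n (toℕ i) 3∣blockSize)

  -- Opaque so that normalising a label never unfolds the divisibility test.
  opaque
    orient : Fin n → Fin m → Fin m
    orient i with 3 ∣? blockStart i
    ... | yes _ = opposite
    ... | no  _ = id

    orient-involutive : ∀ i j → orient i (orient i j) ≡ j
    orient-involutive i j with 3 ∣? blockStart i
    ... | yes _ = opposite-involutive j
    ... | no  _ = refl

    gcd[3,first]≡1 : ∀ i → gcd 3 (blockStart i + toℕ (orient i zero)) ≡ 1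
    gcd[3,first]≡1 i with 3 ∣? blockStart i
    ... | yes 3∣a = prime∤⇒gcd≡1 prime[3] (subst (λ t → ¬ 3 ∣ blockStart i + t)
                      (sym (toℕ-fromℕ m′)) (3∣blockStart⇒3∤blockStart+m′ i 3∣a))
    ... | no  3∤a = prime∤⇒gcd≡1 prime[3] (subst (λ t → ¬ 3 ∣ t)
                      (sym (+-identityʳ (blockStart i))) 3∤a)

    orient-consecutive : ∀ i (j : Fin m′) →
                         Consecutive (toℕ (orient i (inject₁ j))) (toℕ (orient i (suc j)))
    orient-consecutive i j with 3 ∣? blockStart i
    ... | yes _ = inj₂ (trans (toℕ-opposite-inject₁ j) (cong suc (sym (opposite-suc j))))
    ... | no  _ = inj₁ (cong suc (sym (toℕ-inject₁ j)))

  PageItem : Set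
  PageItem = Fin m ⊎ Fin (suc m)

  pageEdge : Fin n → Fin (suc m) → Fin NE
  pageEdge i q = suc (combine i q)

  pageItem : Fin n → PageItem → Fin NV ⊎ Fin NE
  pageItem i = Sum.map (xV i) (pageEdge i)

  reorient : Fin n → PageItem → PageItem
  reorient i = Sum.map₁ (orient i)

  reorient-involutive : ∀ i t → reorient i (reorient i t) ≡ t
  reorient-involutive i (inj₁ j) = cong inj₁ (orient-involutive i j)
  reorient-involutive i (inj₂ q) = refl

  offset : Fin n → PageItem → Fin blockSize
  offset i = join m (suc m) ∘ reorient i

  offset⁻¹ : Fin n → Fin blockSize → PageItem
  offset⁻¹ i = reorient i ∘ splitAt m

  offset⁻¹-offset : ∀ i t → offset⁻¹ i (offset i t) ≡ t
  offset⁻¹-offset i t = begin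
    reorient i (splitAt m (join m (suc m) (reorient i t)))
      ≡⟨ cong (reorient i) (splitAt-join m (suc m) (reorient i t)) ⟩
    reorient i (reorient i t)
      ≡⟨ reorient-involutive i t ⟩
    t ∎
    where open ≡-Reasoning

  offset-offset⁻¹ : ∀ i r → offset i (offset⁻¹ i r) ≡ r
  offset-offset⁻¹ i r = begin
    join m (suc m) (reorient i (reorient i (splitAt m r)))
      ≡⟨ cong (join m (suc m)) (reorient-involutive i (splitAt m r)) ⟩
    join m (suc m) (splitAt m r)
      ≡⟨ join-splitAt m (suc m) r ⟩
    r ∎
    where open ≡-Reasoning

  Slot : Set
  Slot = Fin (3 + n * blockSize)

  inBlock : Fin n → Fin blockSize → Slot
  inBlock i r = suc (suc (suc (combine i r)))

  slot : Fin NV ⊎ Fin NE → Slot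
  slot (inj₁ zero)          = suc (suc zero)
  slot (inj₁ (suc zero))    = zero
  slot (inj₁ (suc (suc c))) = uncurry (λ i j → inBlock i (offset i (inj₁ j))) (remQuot m c)
  slot (inj₂ zero)          = suc zero
  slot (inj₂ (suc e))       = uncurry (λ i q → inBlock i (offset i (inj₂ q))) (remQuot (suc m) e)

  unslot : Slot → Fin NV ⊎ Fin NE
  unslot zero                = inj₁ vV
  unslot (suc zero)          = inj₂ zero
  unslot (suc (suc zero))    = inj₁ uV
  unslot (suc (suc (suc t))) = uncurry (λ i r → pageItem i (offset⁻¹ i r)) (remQuot blockSize t)

  slot-pageItem : ∀ i t → slot (pageItem i t) ≡ inBlock i (offset i t)
  slot-pageItem i (inj₁ j) =
    cong (uncurry (λ i j → inBlock i (offset i (inj₁ j)))) (remQuot-combine i j)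
  slot-pageItem i (inj₂ q) =
    cong (uncurry (λ i q → inBlock i (offset i (inj₂ q)))) (remQuot-combine i q)

  unslot-inBlock : ∀ i r → unslot (inBlock i r) ≡ pageItem i (offset⁻¹ i r)
  unslot-inBlock i r = cong (uncurry (λ i r → pageItem i (offset⁻¹ i r))) (remQuot-combine i r)

  unslot-slot-pageItem : ∀ i t → unslot (slot (pageItem i t)) ≡ pageItem i t
  unslot-slot-pageItem i t = begin
    unslot (slot (pageItem i t))         ≡⟨ cong unslot (slot-pageItem i t) ⟩
    unslot (inBlock i (offset i t))      ≡⟨ unslot-inBlock i (offset i t) ⟩
    pageItem i (offset⁻¹ i (offset i t)) ≡⟨ cong (pageItem i) (offset⁻¹-offset i t) ⟩
    pageItem i t                         ∎
    where open ≡-Reasoning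

  unslot-slot : ∀ x → unslot (slot x) ≡ x
  unslot-slot (inj₁ zero)          = refl
  unslot-slot (inj₁ (suc zero))    = refl
  unslot-slot (inj₁ (suc (suc c))) with combineView n m c
  ... | combined i j = unslot-slot-pageItem i (inj₁ j)
  unslot-slot (inj₂ zero)          = refl
  unslot-slot (inj₂ (suc e))       with combineView n (suc m) e
  ... | combined i q = unslot-slot-pageItem i (inj₂ q)

  slot-unslot : ∀ y → slot (unslot y) ≡ y
  slot-unslot zero                = refl
  slot-unslot (suc zero)          = refl
  slot-unslot (suc (suc zero))    = refl
  slot-unslot (suc (suc (suc t))) with combineView n blockSize t
  ... | combined i r = begin
    slot (unslot (inBlock i r))         ≡⟨ cong slot (unslot-inBlock i r) ⟩
    slot (pageItem i (offset⁻¹ i r))    ≡⟨ slot-pageItem i (offset⁻¹ i r) ⟩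
    inBlock i (offset i (offset⁻¹ i r)) ≡⟨ cong (inBlock i) (offset-offset⁻¹ i r) ⟩
    inBlock i r                         ∎
    where open ≡-Reasoning

  3+n*blockSize≡NV+NE : 3 + n * blockSize ≡ NV + NE
  3+n*blockSize≡NV+NE = identity n m
    where
    identity : ∀ a b → 3 + a * (b + suc b) ≡ (2 + a * b) + suc (a * suc b)
    identity = solve-∀

  opaque
    ℓ : (Fin NV ⊎ Fin NE) ⤖ Fin (NV + NE)
    ℓ = ↔⇒⤖ (↔-trans (mk↔ₛ′ slot unslot slot-unslot unslot-slot) (cast↔ 3+n*blockSize≡NV+NE))

  label : Fin NV ⊎ Fin NE → ℕ
  label x = suc (toℕ (Bijection.to ℓ x))

  vlabel : Fin NV → ℕ
  vlabel a = label (inj₁ a)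

  elabel : Fin NE → ℕ
  elabel e = label (inj₂ e)

  opaque
    unfolding ℓ

    vlabel-u : vlabel uV ≡ 3
    vlabel-u = refl

    vlabel-v : vlabel vV ≡ 1
    vlabel-v = refl

    elabel-uv : elabel zero ≡ 2
    elabel-uv = refl

    label-pageItem : ∀ i t → label (pageItem i t) ≡ blockStart i + toℕ (offset i t)
    label-pageItem i t = begin
      suc (toℕ (cast _ (slot (pageItem i t)))) ≡⟨ cong suc (toℕ-cast _ (slot (pageItem i t))) ⟩
      suc (toℕ (slot (pageItem i t)))          ≡⟨ cong (suc ∘ toℕ) (slot-pageItem i t) ⟩
      4 + toℕ (combine i (offset i t))         ≡⟨ cong (4 +_) (toℕ-combine i (offset i t)) ⟩
      blockStart i + toℕ (offset i t)          ∎
      where open ≡-Reasoning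

  vlabel-x : ∀ i j → vlabel (xV i j) ≡ blockStart i + toℕ (orient i j)
  vlabel-x i j =
    trans (label-pageItem i (inj₁ j)) (cong (blockStart i +_) (toℕ-↑ˡ (orient i j) (suc m)))

  elabel-pageEdge : ∀ i q → elabel (pageEdge i q) ≡ blockStart i + (m + toℕ q)
  elabel-pageEdge i q = trans (label-pageItem i (inj₂ q)) (cong (blockStart i +_) (toℕ-↑ʳ m q))

  posS-inject₁ : ∀ i j → posS i (inject₁ j) ≡ xV i j
  posS-inject₁ i j with toℕ (inject₁ j) ≟ m
  ... | yes m≡j = contradiction (sym m≡j) (toℕ-inject₁-≢ j)
  ... | no  j≢m = cong (xV i) (lower₁-inject₁′ j (j≢m ∘ sym))

  posS-fromℕ : ∀ i → posS i (fromℕ m) ≡ vV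
  posS-fromℕ i with toℕ (fromℕ m) ≟ m
  ... | yes _   = refl
  ... | no  ≢m  = contradiction (toℕ-fromℕ m) ≢m

  ends-pageEdge : ∀ i q → endsB (pageEdge i q) ≡ (pos i (inject₁ q) , posS i q)
  ends-pageEdge i q = cong (λ (i , q) → pos i (inject₁ q) , pos i (suc q)) (remQuot-combine i q)

  EndsCoprime : Fin NV × Fin NV → Set
  EndsCoprime (a , b) = gcd (vlabel a) (vlabel b) ≡ 1

  pageEdge-endsCoprime : ∀ i q → EndsCoprime (pos i (inject₁ q) , posS i q)
  pageEdge-endsCoprime i q with view q
  ... | ‵fromℕ = subst (λ b → EndsCoprime (a , b)) (sym (posS-fromℕ i))
                   (subst (λ b → gcd (vlabel a) b ≡ 1) (sym vlabel-v) (gcd-zeroʳ (vlabel a)))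
    where a = pos i (inject₁ (fromℕ m))
  ... | ‵inj₁ {i = zero} _ = subst (λ b → EndsCoprime (uV , b)) (sym (posS-inject₁ i zero))
    (subst₂ (λ a b → gcd a b ≡ 1) (sym vlabel-u) (sym (vlabel-x i zero)) (gcd[3,first]≡1 i))
  ... | ‵inj₁ {i = suc j} _ =
    subst EndsCoprime (sym (cong₂ _,_ (posS-inject₁ i (inject₁ j)) (posS-inject₁ i (suc j))))
      (subst₂ (λ a b → gcd a b ≡ 1) (sym (vlabel-x i (inject₁ j))) (sym (vlabel-x i (suc j)))
        (consecutive⇒gcd≡1 (+-consecutive (blockStart i) (orient-consecutive i j))))

  endsCoprime : ∀ e → EndsCoprime (endsB e)
  endsCoprime zero    = subst₂ (λ a b → gcd a b ≡ 1) (sym vlabel-u) (sym vlabel-v) refl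
  endsCoprime (suc e) with combineView n (suc m) e
  ... | combined i q = subst EndsCoprime (sym (ends-pageEdge i q)) (pageEdge-endsCoprime i q)

  G : Graph
  G = Book (3 + m′) n

  DividesIncident : ℕ → Fin NV → Set
  DividesIncident d w = ∀ {x} → x ∈ map elabel (incidentEdges G w) → d ∣ x

  ∣elabel : ∀ {d w} → DividesIncident d w → ∀ e → Incident G w e → d ∣ elabel e
  ∣elabel d∣ e w∈e = d∣ (∈-map⁺ elabel (incident⇒∈incidentEdges G w∈e))

  ∣first-pageEdge : ∀ {d} → DividesIncident d uV → ∀ i → d ∣ blockStart i + (m + 0)
  ∣first-pageEdge {d} d∣ i = subst (d ∣_) (elabel-pageEdge i zero)
    (∣elabel d∣ (pageEdge i zero) (inj₁ (cong proj₁ (ends-pageEdge i zero))))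

  u-incident⇒∣1 : ∀ {d} → DividesIncident d uV → d ∣ 1
  u-incident⇒∣1 {d} d∣ = ∣2∧∣1+2q⇒∣1 (4 + (m + m))
    (subst (d ∣_) elabel-uv (∣elabel d∣ zero (inj₁ refl)))
    (subst (d ∣_) (sum≡ m) (∣m∣n⇒∣m+n (∣first-pageEdge d∣ zero) (∣first-pageEdge d∣ (suc zero))))
    where
    sum≡ : ∀ t → (4 + (t + suc t) * 0 + (t + 0)) + (4 + (t + suc t) * 1 + (t + 0))
               ≡ 1 + 2 * (4 + (t + t))
    sum≡ = solve-∀

  v-incident⇒∣1 : ∀ {d} → DividesIncident d vV → d ∣ 1
  v-incident⇒∣1 {d} d∣ = ∣2∧∣1+2q⇒∣1 (2 + (m + m))
    (subst (d ∣_) elabel-uv (∣elabel d∣ zero (inj₂ refl)))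
    (subst (d ∣_) (trans (elabel-pageEdge i₁ (fromℕ m)) (last≡ m))
      (∣elabel d∣ (pageEdge i₁ (fromℕ m)) (inj₂ v∈last)))
    where
    i₁ : Fin n
    i₁ = suc zero
    v∈last : proj₂ (endsB (pageEdge i₁ (fromℕ m))) ≡ vV
    v∈last = trans (cong proj₂ (ends-pageEdge i₁ (fromℕ m))) (posS-fromℕ i₁)
    odd : ∀ t → 4 + (t + suc t) * 1 + (t + t) ≡ 1 + 2 * (2 + (t + t))
    odd = solve-∀
    last≡ : ∀ t → 4 + (t + suc t) * 1 + (t + toℕ (fromℕ t)) ≡ 1 + 2 * (2 + (t + t))
    last≡ t rewrite toℕ-fromℕ t = odd t

  x-incident⇒∣1 : ∀ {d} i j → DividesIncident d (xV i j) → d ∣ 1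
  x-incident⇒∣1 {d} i j d∣ = consecutive⇒∣1 (+-consecutive (blockStart i) (+-consecutive m next))
    (subst (d ∣_) (elabel-pageEdge i (inject₁ j))
      (∣elabel d∣ (pageEdge i (inject₁ j)) (inj₂ x∈before)))
    (subst (d ∣_) (elabel-pageEdge i (suc j)) (∣elabel d∣ (pageEdge i (suc j)) (inj₁ x∈after)))
    where
    next : Consecutive (toℕ (inject₁ j)) (suc (toℕ j))
    next = inj₁ (cong suc (sym (toℕ-inject₁ j)))
    x∈before : proj₂ (endsB (pageEdge i (inject₁ j))) ≡ xV i j
    x∈before = trans (cong proj₂ (ends-pageEdge i (inject₁ j))) (posS-inject₁ i j)
    x∈after : proj₁ (endsB (pageEdge i (suc j))) ≡ xV i j
    x∈after = trans (cong proj₁ (ends-pageEdge i (suc j))) (posS-inject₁ i j)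

  incident⇒∣1 : ∀ {d} w → DividesIncident d w → d ∣ 1
  incident⇒∣1 zero          = u-incident⇒∣1
  incident⇒∣1 (suc zero)    = v-incident⇒∣1
  incident⇒∣1 (suc (suc c)) with combineView n m c
  ... | combined i j = x-incident⇒∣1 i j

  adjacent⇒gcd≡1 : ∀ a b → Adjacent G a b → gcd (vlabel a) (vlabel b) ≡ 1
  adjacent⇒gcd≡1 a b (e , inj₁ ends≡) = subst EndsCoprime ends≡ (endsCoprime e)
  adjacent⇒gcd≡1 a b (e , inj₂ ends≡) =
    trans (gcd-comm (vlabel a) (vlabel b)) (subst EndsCoprime ends≡ (endsCoprime e))

  totalPrime : TotalPrime G
  totalPrime = record
    { ℓ          = ℓ
    ; vertexCond = adjacent⇒gcd≡1
    ; edgeCond   = λ w _ → foldr-gcd≡1 (incident⇒∣1 w)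
    }

mainTheorem5 : (k n : ℕ) → 3 ≤ k → 3 ≤ n → TotalPrime (Book k n)
mainTheorem5 (suc (suc (suc m′))) (suc (suc n′)) (s≤s (s≤s (s≤s z≤n))) (s≤s (s≤s _)) =
  BookLabelling.totalPrime m′ n′
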